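{- Let $t$ be a closed term. The following are equivalent: (1) $t$ is $\rhd\beta_v$-normalizable; (2) $t$ reduces by finitely many $\rhd\beta_v$-steps to some closed value $v$; (3) $t\simeq_{\beta_v}v$ for some closed value $v$; (4) $[\![t]\!]_{\vec{x}}\neq\emptyset$ for any list $\vec{x}=(x_1,\dots,x_k)$ ($k\in\mathbb{N}$) of pairwise distinct variables; (5) $((\mathbf{0},\dots,\mathbf{0}),\mathbf{0})\in[\![t]\!]_{\vec{x}}$ (with $k$ copies of $\mathbf{0}$) for any list $\vec{x}=(x_1,\dots,x_k)$ ($k\in\mathbb{N}$) of pairwise distinct variables; (6) there exists a derivation with conclusion $\vdash t\colon\mathbf{0}$ (empty environment); (7) there exists a derivation with conclusion $\vdash t\colon Q$ (empty environment) for some positive type $Q$; (8) $t$ is strongly $\rhd\beta_v$-normalizable.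
   Context: Terms: $t ::= x \mid \lambda x.t \mid tu$ (up to $\alpha$); values $v ::= x \mid \lambda x.t$; a term is closed if it has no free variables; $t\{v/x\}$ substitution. Root step ($\beta_v$): $(\lambda x.t)v \mapsto t\{v/x\}$ with $v$ a value. Balanced contexts $B ::= [\cdot] \mid (\lambda x.B)t \mid Bt \mid tB$; $\rhd\beta_v$-reduction is the closure of the root step under balanced contexts; $\beta_v$-reduction is its closure under arbitrary contexts (including under $\lambda$), and $\simeq_{\beta_v}$ the reflexive-symmetric-transitive closure of $\beta_v$-reduction. Types: positive types are finite multisets $[(P_1,Q_1),\dots,(P_n,Q_n)]$ of pairs of positive types ($\mathbf{0}$ empty, $\uplus$ union). Environments map variables to positive types (finitely many non-$\mathbf{0}$), combined pointwise by $\uplus$. Rules: (ax) $x\colon P\vdash x\colon P$; ($\lambda$) from $\Gamma_i,x\colon P_i\vdash t\colon Q_i$ ($1\le i\le n$, $n\ge0$) infer $\biguplus_i\Gamma_i\vdash\lambda x.t\colon[(P_1,Q_1),\dots,(P_n,Q_n)]$; ($@$) from $\Gamma\vdash t\colon[(P,Q)]$ and $\Delta\vdash u\colon P$ infer $\Gamma\uplus\Delta\vdash tu\colon Q$. Relational semantics: $[\![t]\!]_{\vec{x}}=\{((P_1,\dots,P_k),Q)\mid x_1\colon P_1,\dots,x_k\colon P_k\vdash t\colon Q\text{ derivable}\}$. -}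

module Defs where

open import Data.Nat using (ℕ; zero; suc; pred; _<_; _≡ᵇ_; _<ᵇ_)
open import Data.Bool using (if_then_else_)
open import Data.List using (List; []; _∷_; _++_; map; foldr; length)
open import Data.List.Relation.Unary.All using (All)
open import Data.List.Relation.Binary.Permutation.Homogeneous using (Permutation)
open import Data.Vec using (Vec; []; _∷_)
open import Data.Product using (_×_; _,_; proj₁; Σ; ∃)
open import Relation.Nullary using (¬_)
open import Relation.Binary.Construct.Closure.ReflexiveTransitive using (Star)
open import Relation.Binary.Construct.Closure.Equivalence using (EqClosure)
open import Induction.WellFounded using (Acc)

-- Terms: untyped λ-terms with de Bruijn indices (this is "up to α").
-- A free variable is an index not bound by an enclosing λ.

data Term : Set where
  var : ℕ → Term
  lam : Term → Term
  app : Term → Term → Term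

data Value : Term → Set where
  var : ∀ {x} → Value (var x)
  lam : ∀ {t} → Value (lam t)

data ClosedAt : ℕ → Term → Set where
  var : ∀ {n x} → x < n → ClosedAt n (var x)
  lam : ∀ {n t} → ClosedAt (suc n) t → ClosedAt n (lam t)
  app : ∀ {n t u} → ClosedAt n t → ClosedAt n u → ClosedAt n (app t u)

Closed : Term → Set
Closed = ClosedAt 0

shift : ℕ → Term → Term
shift c (var x)   = if x <ᵇ c then var x else var (suc x)
shift c (lam t)   = lam (shift (suc c) t)
shift c (app t u) = app (shift c t) (shift c u)

-- substitution of s for index j (indices above j are decremented,
-- since the binder for j disappears)
subst : ℕ → Term → Term → Term
subst j s (var x)   = if x ≡ᵇ j then s else (if x <ᵇ j then var x else var (pred x))
subst j s (lam t)   = lam (subst (suc j) (shift 0 s) t)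
subst j s (app t u) = app (subst j s t) (subst j s u)

-- t{v/x} where x is the variable bound by the λ whose body is t
_[_] : Term → Term → Term
t [ v ] = subst 0 v t

data _↦_ : Term → Term → Set where
  βv : ∀ {t v} → Value v → app (lam t) v ↦ (t [ v ])

-- ▷β_v : closure of ↦ under balanced contexts
--   B ::= [·] | (λx.B)t | Bt | tB
data _▷_ : Term → Term → Set where
  root   : ∀ {t t'} → t ↦ t' → t ▷ t'
  redexB : ∀ {t t' u} → t ▷ t' → app (lam t) u ▷ app (lam t') u
  appL   : ∀ {t t' u} → t ▷ t' → app t u ▷ app t' u
  appR   : ∀ {t u u'} → u ▷ u' → app t u ▷ app t u'

data _→βv_ : Term → Term → Set where
  root : ∀ {t t'} → t ↦ t' → t →βv t'
  lamC : ∀ {t t'} → t →βv t' → lam t →βv lam t'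
  appL : ∀ {t t' u} → t →βv t' → app t u →βv app t' u
  appR : ∀ {t u u'} → u →βv u' → app t u →βv app t u'

_▷*_ : Term → Term → Set
_▷*_ = Star _▷_

_≃βv_ : Term → Term → Set
_≃βv_ = EqClosure _→βv_

▷-Normal : Term → Set
▷-Normal t = ∀ {t'} → ¬ (t ▷ t')

▷-Normalizable : Term → Set
▷-Normalizable t = ∃ λ s → (t ▷* s) × ▷-Normal s

▷-SN : Term → Set
▷-SN = Acc (λ s t → t ▷ s)

-- Positive types: finite multisets of pairs of positive types.
-- Represented by lists, identified up to (nested) permutation _≈_.

data Pos : Set where
  mk : List (Pos × Pos) → Pos

mutual
  data _≈_ : Pos → Pos → Set where
    mk : ∀ {xs ys} → Permutation _≈₂_ xs ys → mk xs ≈ mk ys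

  data _≈₂_ : (Pos × Pos) → (Pos × Pos) → Set where
    _,_ : ∀ {P P' Q Q'} → P ≈ P' → Q ≈ Q' → (P , Q) ≈₂ (P' , Q')

𝟘 : Pos
𝟘 = mk []

_⊎_ : Pos → Pos → Pos
mk xs ⊎ mk ys = mk (xs ++ ys)

Env : Set
Env = ℕ → Pos

∅ : Env
∅ _ = 𝟘

_⊎ₑ_ : Env → Env → Env
(Γ ⊎ₑ Δ) x = Γ x ⊎ Δ x

⨄ : List Env → Env
⨄ = foldr _⊎ₑ_ ∅

_≈ₑ_ : Env → Env → Set
Γ ≈ₑ Δ = ∀ x → Γ x ≈ Δ x

single : ℕ → Pos → Env
single x P y = if y ≡ᵇ x then P else 𝟘

-- Γ , x : P   where x is the variable bound by the enclosing λ (index 0)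
_∷ₑ_ : Pos → Env → Env
(P ∷ₑ Γ) zero    = P
(P ∷ₑ Γ) (suc y) = Γ y

-- Typing derivations (conclusions taken up to multiset equality ≈).

data _⊢_∶_ : Env → Term → Pos → Set where
  ax  : ∀ {Γ x P} → Γ ≈ₑ single x P → Γ ⊢ var x ∶ P
  lam : ∀ {Γ t A} (ps : List (Env × Pos × Pos)) →
        All (λ { (Γi , Pi , Qi) → (Pi ∷ₑ Γi) ⊢ t ∶ Qi }) ps →
        Γ ≈ₑ ⨄ (map proj₁ ps) →
        A ≈ mk (map (λ { (_ , Pi , Qi) → (Pi , Qi) }) ps) →
        Γ ⊢ lam t ∶ A
  app : ∀ {Γ Δ Θ t u A P Q} →
        Γ ⊢ t ∶ A → A ≈ mk ((P , Q) ∷ []) →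
        Δ ⊢ u ∶ P →
        Θ ≈ₑ (Γ ⊎ₑ Δ) →
        Θ ⊢ app t u ∶ Q

envOf : (xs : List ℕ) → Vec Pos (length xs) → Env
envOf []       []       = ∅
envOf (x ∷ xs) (P ∷ Ps) = single x P ⊎ₑ envOf xs Ps

⟦_⟧_ : Term → (xs : List ℕ) → Vec Pos (length xs) × Pos → Set
(⟦ t ⟧ xs) (Ps , Q) = envOf xs Ps ⊢ t ∶ Q

-- Typing derivations carry a size, and a balanced step strictly decreases
-- the size of every derivation of its source.  In a βv-redex the argument is
-- a value, and the typing of a value at a multiset P₁ ⊎ P₂ splits into
-- typings at P₁ and at P₂ (at 𝟘 it costs nothing), so the value's derivation
-- can be shared out among the occurrences of the bound variable: substitution
-- does not increase the size, while the application node disappears.  Hence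
-- typable terms are strongly ▷-normalizable.  Conversely, a closed ▷-normal
-- term is a value, every value has type 𝟘 in the empty environment, and by
-- subject reduction and expansion (the latter from the converse substitution
-- lemma) typing is invariant under βv-conversion; so a term convertible to a
-- closed value is typable with 𝟘, and the other conditions lie in between.

module Submission where

open import Defs
open import Algebra.Bundles using (CommutativeMonoid)
open import Algebra.Structures using (IsCommutativeMonoid)
import Algebra.Properties.CommutativeSemigroup as CommutativeSemigroupProperties
open import Data.Bool using (true; false)
open import Data.Empty using (⊥-elim)
open import Data.List using (List; []; _∷_; _++_; map; length)
open import Data.List.Properties using (++-assoc; ++-identityʳ; map-++)
open import Data.List.Relation.Binary.Permutation.Homogeneous as Perm using (Permutation)
open import Data.List.Relation.Binary.Permutation.Propositional using (_↭_; prep; swap)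
  renaming (refl to ↭-refl; trans to ↭-trans)
open import Data.List.Relation.Binary.Permutation.Propositional.Properties
  using (↭-empty-inv; ↭-singleton-inv; ↭-map-inv)
import Data.List.Relation.Binary.Permutation.Setoid.Properties as SetoidPermutationProperties
open import Data.List.Relation.Binary.Pointwise.Base using (Pointwise; []; _∷_)
open import Data.List.Relation.Binary.Pointwise.Properties as Pointwise using ()
open import Data.List.Relation.Unary.All using (All; []; _∷_)
open import Data.List.Relation.Unary.AllPairs.Core using ([])
open import Data.List.Relation.Unary.Unique.Propositional using (Unique)
open import Data.Nat using (ℕ; zero; suc; pred; _+_; _≤_; _<_; z≤n; s≤s; _≡ᵇ_; _<ᵇ_)
open import Data.Nat.Properties
  using (+-identityʳ; +-assoc; +-commutativeSemigroup; ≤-reflexive; ≤-refl; ≤-trans;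
         +-mono-≤; +-monoˡ-<; +-monoʳ-<; module ≤-Reasoning)
open import Data.Product using (_×_; _,_; proj₁; proj₂; Σ; ∃; ∃-syntax)
open import Data.Sum using (inj₁; inj₂) renaming (_⊎_ to _⊎′_)
open import Data.Vec using (replicate)
open import Function using (_∘_)
open import Function.Bundles using (_⇔_; mk⇔)
open import Induction.WellFounded using (acc)
open import Relation.Binary.Bundles using (Setoid)
open import Relation.Binary.Construct.Closure.ReflexiveTransitive using (ε; _◅_)
open import Relation.Binary.Construct.Closure.Symmetric using (fwd; bwd)
open import Relation.Binary.Definitions using (Reflexive; Symmetric; Transitive)
open import Relation.Binary.PropositionalEquality using (_≡_; refl; sym; trans; cong; cong₂)

-- Positive types up to multiset equality

-- The library's refl and sym for Pointwise and Permutation take the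
-- element-level proof as an argument, which hides the nested recursion
-- from the termination checker; hence the explicit mutual definitions.
mutual
  ≈-refl : Reflexive _≈_
  ≈-refl {mk xs} = mk (Perm.refl ≋-refl)

  ≈₂-refl : Reflexive _≈₂_
  ≈₂-refl {P , Q} = ≈-refl , ≈-refl

  ≋-refl : Reflexive (Pointwise _≈₂_)
  ≋-refl {[]}     = []
  ≋-refl {x ∷ xs} = ≈₂-refl ∷ ≋-refl

mutual
  ≈-sym : Symmetric _≈_
  ≈-sym (mk p) = mk (↭ₛ-sym p)

  ≈₂-sym : Symmetric _≈₂_
  ≈₂-sym (p , q) = ≈-sym p , ≈-sym q

  ≋-sym : Symmetric (Pointwise _≈₂_)
  ≋-sym []       = []
  ≋-sym (r ∷ rs) = ≈₂-sym r ∷ ≋-sym rs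

  ↭ₛ-sym : Symmetric (Permutation _≈₂_)
  ↭ₛ-sym (Perm.refl rs)     = Perm.refl (≋-sym rs)
  ↭ₛ-sym (Perm.prep r p)    = Perm.prep (≈₂-sym r) (↭ₛ-sym p)
  ↭ₛ-sym (Perm.swap r s p)  = Perm.swap (≈₂-sym s) (≈₂-sym r) (↭ₛ-sym p)
  ↭ₛ-sym (Perm.trans p q)   = Perm.trans (↭ₛ-sym q) (↭ₛ-sym p)

≈-trans : Transitive _≈_
≈-trans (mk p) (mk q) = mk (Perm.trans p q)

≈₂-trans : Transitive _≈₂_
≈₂-trans (p , q) (p' , q') = ≈-trans p p' , ≈-trans q q'

≈-reflexive : ∀ {P Q} → P ≡ Q → P ≈ Q
≈-reflexive refl = ≈-refl

≈₂-setoid : Setoid _ _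
≈₂-setoid = record
  { _≈_ = _≈₂_
  ; isEquivalence = record { refl = ≈₂-refl ; sym = ≈₂-sym ; trans = ≈₂-trans } }

open SetoidPermutationProperties ≈₂-setoid using (++⁺; ++-comm)

⊎-cong : ∀ {P P' Q Q'} → P ≈ P' → Q ≈ Q' → (P ⊎ Q) ≈ (P' ⊎ Q')
⊎-cong {mk _} {mk _} {mk _} {mk _} (mk p) (mk q) = mk (++⁺ p q)

⊎-comm : ∀ P Q → (P ⊎ Q) ≈ (Q ⊎ P)
⊎-comm (mk xs) (mk ys) = mk (++-comm xs ys)

⊎-assoc : ∀ P Q R → ((P ⊎ Q) ⊎ R) ≈ (P ⊎ (Q ⊎ R))
⊎-assoc (mk xs) (mk ys) (mk zs) = ≈-reflexive (cong mk (++-assoc xs ys zs))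

⊎-identityˡ : ∀ P → (𝟘 ⊎ P) ≈ P
⊎-identityˡ (mk xs) = ≈-refl

⊎-identityʳ : ∀ P → (P ⊎ 𝟘) ≈ P
⊎-identityʳ (mk xs) = ≈-reflexive (cong mk (++-identityʳ xs))

⊎-isCommutativeMonoid : IsCommutativeMonoid _≈_ _⊎_ 𝟘
⊎-isCommutativeMonoid = record
  { isMonoid = record
    { isSemigroup = record
      { isMagma = record
        { isEquivalence = record { refl = ≈-refl ; sym = ≈-sym ; trans = ≈-trans }
        ; ∙-cong = ⊎-cong }
      ; assoc = ⊎-assoc }
    ; identity = ⊎-identityˡ , ⊎-identityʳ }
  ; comm = ⊎-comm }

⊎-commutativeMonoid : CommutativeMonoid _ _
⊎-commutativeMonoid = record { isCommutativeMonoid = ⊎-isCommutativeMonoid }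

open CommutativeSemigroupProperties (CommutativeMonoid.commutativeSemigroup ⊎-commutativeMonoid)
  using () renaming (interchange to ⊎-interchange)

_⇒_ : Pos → Pos → Pos
P ⇒ Q = mk ((P , Q) ∷ [])

⇒-cong : ∀ {P P' Q Q'} → P ≈ P' → Q ≈ Q' → (P ⇒ Q) ≈ (P' ⇒ Q')
⇒-cong p q = mk (Perm.prep (p , q) (Perm.refl []))

≋-↭-commute : ∀ {as bs cs} → Pointwise _≈₂_ as bs → bs ↭ cs →
              ∃[ as' ] (as ↭ as' × Pointwise _≈₂_ as' cs)
≋-↭-commute rs ↭-refl = _ , ↭-refl , rs
≋-↭-commute (r ∷ rs) (prep _ p) with ≋-↭-commute rs p
... | _ , q , rs' = _ , prep _ q , r ∷ rs'
≋-↭-commute (r ∷ s ∷ rs) (swap _ _ p) with ≋-↭-commute rs p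
... | _ , q , rs' = _ , swap _ _ q , s ∷ r ∷ rs'
≋-↭-commute rs (↭-trans p q) with ≋-↭-commute rs p
... | _ , p' , rs' with ≋-↭-commute rs' q
... | _ , q' , rs'' = _ , ↭-trans p' q' , rs''

Permutation⇒↭-≋ : ∀ {xs ys} → Permutation _≈₂_ xs ys → ∃[ zs ] (xs ↭ zs × Pointwise _≈₂_ zs ys)
Permutation⇒↭-≋ (Perm.refl rs) = _ , ↭-refl , rs
Permutation⇒↭-≋ (Perm.prep r p) with Permutation⇒↭-≋ p
... | _ , q , rs = _ , prep _ q , r ∷ rs
Permutation⇒↭-≋ (Perm.swap r s p) with Permutation⇒↭-≋ p
... | _ , q , rs = _ , swap _ _ q , s ∷ r ∷ rs
Permutation⇒↭-≋ (Perm.trans p q) with Permutation⇒↭-≋ p | Permutation⇒↭-≋ q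
... | _ , p' , rs | _ , q' , ss with ≋-↭-commute rs q'
... | _ , q'' , rs' = _ , ↭-trans p' q'' , Pointwise.transitive ≈₂-trans rs' ss

≈𝟘-inv : ∀ {xs} → mk xs ≈ 𝟘 → xs ≡ []
≈𝟘-inv (mk p) with Permutation⇒↭-≋ p
... | [] , q , [] = ↭-empty-inv q

≈-singleton-inv : ∀ {xs y} → mk xs ≈ mk (y ∷ []) → ∃[ x ] (xs ≡ x ∷ [] × x ≈₂ y)
≈-singleton-inv (mk p) with Permutation⇒↭-≋ p
... | x ∷ [] , q , r ∷ [] = x , ↭-singleton-inv q , r

map-≋-++-inv : ∀ {A : Set} (f : A → Pos × Pos) ps xs {ys} →
               Pointwise _≈₂_ (map f ps) (xs ++ ys) →
               ∃[ ps₁ ] ∃[ ps₂ ] (ps ≡ ps₁ ++ ps₂ ×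
                 Pointwise _≈₂_ (map f ps₁) xs × Pointwise _≈₂_ (map f ps₂) ys)
map-≋-++-inv f ps [] rs = [] , ps , refl , [] , rs
map-≋-++-inv f (p ∷ ps) (x ∷ xs) (r ∷ rs) with map-≋-++-inv f ps xs rs
... | ps₁ , ps₂ , refl , rs₁ , rs₂ = p ∷ ps₁ , ps₂ , refl , r ∷ rs₁ , rs₂

≈-map-++-inv : ∀ {A : Set} (f : A → Pos × Pos) ps xs ys → mk (map f ps) ≈ mk (xs ++ ys) →
               ∃[ ps₁ ] ∃[ ps₂ ] (ps ↭ ps₁ ++ ps₂ × mk (map f ps₁) ≈ mk xs × mk (map f ps₂) ≈ mk ys)
≈-map-++-inv f ps xs ys (mk p) with Permutation⇒↭-≋ p
... | _ , q , rs with ↭-map-inv f q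
... | ps' , refl , ps↭ps' with map-≋-++-inv f ps' xs rs
... | ps₁ , ps₂ , refl , rs₁ , rs₂ = ps₁ , ps₂ , ps↭ps' , mk (Perm.refl rs₁) , mk (Perm.refl rs₂)

-- Environments and de Bruijn indices

≈ₑ-refl : ∀ {Γ} → Γ ≈ₑ Γ
≈ₑ-refl _ = ≈-refl

≈ₑ-sym : ∀ {Γ Δ} → Γ ≈ₑ Δ → Δ ≈ₑ Γ
≈ₑ-sym e x = ≈-sym (e x)

≈ₑ-trans : ∀ {Γ Δ Θ} → Γ ≈ₑ Δ → Δ ≈ₑ Θ → Γ ≈ₑ Θ
≈ₑ-trans e f x = ≈-trans (e x) (f x)

⊎ₑ-cong : ∀ {Γ Γ' Δ Δ'} → Γ ≈ₑ Γ' → Δ ≈ₑ Δ' → (Γ ⊎ₑ Δ) ≈ₑ (Γ' ⊎ₑ Δ')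
⊎ₑ-cong e f x = ⊎-cong (e x) (f x)

⊎ₑ-identityˡ : ∀ Γ → (∅ ⊎ₑ Γ) ≈ₑ Γ
⊎ₑ-identityˡ Γ x = ⊎-identityˡ (Γ x)

⊎ₑ-identityʳ : ∀ Γ → (Γ ⊎ₑ ∅) ≈ₑ Γ
⊎ₑ-identityʳ Γ x = ⊎-identityʳ (Γ x)

⊎ₑ-assoc : ∀ Γ Δ Θ → ((Γ ⊎ₑ Δ) ⊎ₑ Θ) ≈ₑ (Γ ⊎ₑ (Δ ⊎ₑ Θ))
⊎ₑ-assoc Γ Δ Θ x = ⊎-assoc (Γ x) (Δ x) (Θ x)

⊎ₑ-comm : ∀ Γ Δ → (Γ ⊎ₑ Δ) ≈ₑ (Δ ⊎ₑ Γ)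
⊎ₑ-comm Γ Δ x = ⊎-comm (Γ x) (Δ x)

⊎ₑ-interchange : ∀ Γ Δ Θ Λ → ((Γ ⊎ₑ Δ) ⊎ₑ (Θ ⊎ₑ Λ)) ≈ₑ ((Γ ⊎ₑ Θ) ⊎ₑ (Δ ⊎ₑ Λ))
⊎ₑ-interchange Γ Δ Θ Λ x = ⊎-interchange (Γ x) (Δ x) (Θ x) (Λ x)

∷ₑ-cong : ∀ {P P' Γ Γ'} → P ≈ P' → Γ ≈ₑ Γ' → (P ∷ₑ Γ) ≈ₑ (P' ∷ₑ Γ')
∷ₑ-cong p g zero    = p
∷ₑ-cong p g (suc y) = g y

∷ₑ-⊎ₑ : ∀ P Q Γ Δ → ((P ∷ₑ Γ) ⊎ₑ (Q ∷ₑ Δ)) ≈ₑ ((P ⊎ Q) ∷ₑ (Γ ⊎ₑ Δ))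
∷ₑ-⊎ₑ P Q Γ Δ zero    = ≈-refl
∷ₑ-⊎ₑ P Q Γ Δ (suc y) = ≈-refl

-- As for Fin.punchIn, punchIn j enumerates the indices other than j.

punchIn : ℕ → ℕ → ℕ
punchIn zero    y       = suc y
punchIn (suc j) zero    = zero
punchIn (suc j) (suc y) = suc (punchIn j y)

data PunchInView (j : ℕ) : ℕ → Set where
  here  : PunchInView j j
  there : ∀ y → PunchInView j (punchIn j y)

punchInView : ∀ j x → PunchInView j x
punchInView zero    zero    = here
punchInView zero    (suc x) = there x
punchInView (suc j) zero    = there zero
punchInView (suc j) (suc x) with punchInView j x
... | here    = here
... | there y = there (suc y)

≡ᵇ-refl : ∀ n → (n ≡ᵇ n) ≡ true
≡ᵇ-refl zero    = refl
≡ᵇ-refl (suc n) = ≡ᵇ-refl n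

punchIn-≢ : ∀ j y → (punchIn j y ≡ᵇ j) ≡ false
punchIn-≢ zero    y       = refl
punchIn-≢ (suc j) zero    = refl
punchIn-≢ (suc j) (suc y) = punchIn-≢ j y

punchIn-≢' : ∀ j y → (j ≡ᵇ punchIn j y) ≡ false
punchIn-≢' zero    y       = refl
punchIn-≢' (suc j) zero    = refl
punchIn-≢' (suc j) (suc y) = punchIn-≢' j y

punchIn-≡ᵇ : ∀ j y x → (punchIn j y ≡ᵇ punchIn j x) ≡ (y ≡ᵇ x)
punchIn-≡ᵇ zero    y       x       = refl
punchIn-≡ᵇ (suc j) zero    zero    = refl
punchIn-≡ᵇ (suc j) zero    (suc x) = refl
punchIn-≡ᵇ (suc j) (suc y) zero    = refl
punchIn-≡ᵇ (suc j) (suc y) (suc x) = punchIn-≡ᵇ j y x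

punchIn-<ᵇ : ∀ j y → (punchIn j y <ᵇ j) ≡ (y <ᵇ j)
punchIn-<ᵇ zero    y       = refl
punchIn-<ᵇ (suc j) zero    = refl
punchIn-<ᵇ (suc j) (suc y) = punchIn-<ᵇ j y

punchIn-below : ∀ j y → (y <ᵇ j) ≡ true → punchIn j y ≡ y
punchIn-below (suc j) zero    _ = refl
punchIn-below (suc j) (suc y) e = cong suc (punchIn-below j y e)

punchIn-above : ∀ j y → (y <ᵇ j) ≡ false → punchIn j y ≡ suc y
punchIn-above zero    y       _ = refl
punchIn-above (suc j) (suc y) e = cong suc (punchIn-above j y e)

shift-var : ∀ c x → shift c (var x) ≡ var (punchIn c x)
shift-var c x with x <ᵇ c in e
... | true  = cong var (sym (punchIn-below c x e))
... | false = cong var (sym (punchIn-above c x e))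

subst-var-here : ∀ j s → subst j s (var j) ≡ s
subst-var-here j s rewrite ≡ᵇ-refl j = refl

subst-var-punchIn : ∀ j y s → subst j s (var (punchIn j y)) ≡ var y
subst-var-punchIn j y s rewrite punchIn-≢ j y | punchIn-<ᵇ j y with y <ᵇ j in e
... | true  = cong var (punchIn-below j y e)
... | false = cong (λ k → var (pred k)) (punchIn-above j y e)

≈ₑ-punchIn : ∀ j {Γ Δ} → Γ j ≈ Δ j → (∀ y → Γ (punchIn j y) ≈ Δ (punchIn j y)) → Γ ≈ₑ Δ
≈ₑ-punchIn j at off x with punchInView j x
... | here    = at
... | there y = off y

insertAt : Env → ℕ → Pos → Env
insertAt Γ zero    P = P ∷ₑ Γ
insertAt Γ (suc j) P = Γ zero ∷ₑ insertAt (λ y → Γ (suc y)) j P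

removeAt : Env → ℕ → Env
removeAt Γ j y = Γ (punchIn j y)

insertAt-here : ∀ Γ j P → insertAt Γ j P j ≡ P
insertAt-here Γ zero    P = refl
insertAt-here Γ (suc j) P = insertAt-here (λ y → Γ (suc y)) j P

insertAt-punchIn : ∀ Γ j P y → insertAt Γ j P (punchIn j y) ≡ Γ y
insertAt-punchIn Γ zero    P y       = refl
insertAt-punchIn Γ (suc j) P zero    = refl
insertAt-punchIn Γ (suc j) P (suc y) = insertAt-punchIn (λ y → Γ (suc y)) j P y

≈ₑ-insertAt : ∀ j {Γ Δ P} → Γ j ≈ P → removeAt Γ j ≈ₑ Δ → Γ ≈ₑ insertAt Δ j P
≈ₑ-insertAt j {Δ = Δ} {P} at off = ≈ₑ-punchIn j
  (≈-trans at (≈-reflexive (sym (insertAt-here Δ j P))))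
  (λ y → ≈-trans (off y) (≈-reflexive (sym (insertAt-punchIn Δ j P y))))

≈ₑ-insertAt-here : ∀ j {Γ Δ P} → Γ ≈ₑ insertAt Δ j P → Γ j ≈ P
≈ₑ-insertAt-here j {Δ = Δ} {P} e = ≈-trans (e j) (≈-reflexive (insertAt-here Δ j P))

≈ₑ-insertAt-removeAt : ∀ j {Γ Δ P} → Γ ≈ₑ insertAt Δ j P → removeAt Γ j ≈ₑ Δ
≈ₑ-insertAt-removeAt j {Δ = Δ} {P} e y =
  ≈-trans (e (punchIn j y)) (≈-reflexive (insertAt-punchIn Δ j P y))

insertAt-injective : ∀ j {Γ Γ' P P'} → insertAt Γ j P ≈ₑ insertAt Γ' j P' → P ≈ P' × Γ ≈ₑ Γ'
insertAt-injective j {Γ} {P = P} e =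
  ≈-trans (≈-sym (≈-reflexive (insertAt-here Γ j P))) (≈ₑ-insertAt-here j e) ,
  λ y → ≈-trans (≈-sym (≈-reflexive (insertAt-punchIn Γ j P y))) (≈ₑ-insertAt-removeAt j e y)

insertAt-removeAt : ∀ Γ j → Γ ≈ₑ insertAt (removeAt Γ j) j (Γ j)
insertAt-removeAt Γ j = ≈ₑ-insertAt j ≈-refl ≈ₑ-refl

insertAt-cong : ∀ j {Γ Γ' P P'} → Γ ≈ₑ Γ' → P ≈ P' → insertAt Γ j P ≈ₑ insertAt Γ' j P'
insertAt-cong j {Γ} {P = P} e p =
  ≈ₑ-insertAt j (≈-trans (≈-reflexive (insertAt-here Γ j P)) p)
    (λ y → ≈-trans (≈-reflexive (insertAt-punchIn Γ j P y)) (e y))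

insertAt-⊎ : ∀ Γ Δ j P Q → insertAt (Γ ⊎ₑ Δ) j (P ⊎ Q) ≈ₑ (insertAt Γ j P ⊎ₑ insertAt Δ j Q)
insertAt-⊎ Γ Δ j P Q = ≈ₑ-sym (≈ₑ-insertAt j
  (≈-reflexive (cong₂ _⊎_ (insertAt-here Γ j P) (insertAt-here Δ j Q)))
  (λ y → ≈-reflexive (cong₂ _⊎_ (insertAt-punchIn Γ j P y) (insertAt-punchIn Δ j Q y))))

removeAt-∷ₑ : ∀ P Γ c → removeAt (P ∷ₑ Γ) (suc c) ≈ₑ (P ∷ₑ removeAt Γ c)
removeAt-∷ₑ P Γ c zero    = ≈-refl
removeAt-∷ₑ P Γ c (suc y) = ≈-refl

insertAt-∅ : ∀ j → insertAt ∅ j 𝟘 ≈ₑ ∅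
insertAt-∅ j = ≈ₑ-sym (≈ₑ-insertAt j ≈-refl ≈ₑ-refl)

single-self : ∀ x P → single x P x ≡ P
single-self x P rewrite ≡ᵇ-refl x = refl

single-punchIn : ∀ j x P y → single (punchIn j x) P (punchIn j y) ≡ single x P y
single-punchIn j x P y rewrite punchIn-≡ᵇ j y x = refl

single-punchIn-at : ∀ j x P → single (punchIn j x) P j ≡ 𝟘
single-punchIn-at j x P rewrite punchIn-≢' j x = refl

single-at-punchIn : ∀ j P y → single j P (punchIn j y) ≡ 𝟘
single-at-punchIn j P y rewrite punchIn-≢ j y = refl

single-cong : ∀ x {P Q} → P ≈ Q → single x P ≈ₑ single x Q
single-cong x p y with y ≡ᵇ x
... | true  = p
... | false = ≈-refl

single-𝟘 : ∀ x → single x 𝟘 ≈ₑ ∅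
single-𝟘 x y with y ≡ᵇ x
... | true  = ≈-refl
... | false = ≈-refl

single-⊎ : ∀ x P Q → single x (P ⊎ Q) ≈ₑ (single x P ⊎ₑ single x Q)
single-⊎ x P Q y with y ≡ᵇ x
... | true  = ≈-refl
... | false = ≈-refl

insertAt-single : ∀ j y Q → insertAt (single y Q) j 𝟘 ≈ₑ single (punchIn j y) Q
insertAt-single j y Q = ≈ₑ-sym (≈ₑ-insertAt j (≈-reflexive (single-punchIn-at j y Q))
  (λ z → ≈-reflexive (single-punchIn j y Q z)))

insertAt-∅-single : ∀ j Q → insertAt ∅ j Q ≈ₑ single j Q
insertAt-∅-single j Q = ≈ₑ-sym (≈ₑ-insertAt j (≈-reflexive (single-self j Q))
  (λ z → ≈-reflexive (single-at-punchIn j Q z)))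

-- Sized typing derivations

open CommutativeSemigroupProperties +-commutativeSemigroup
  using (x∙yz≈y∙xz) renaming (interchange to +-interchange)

Premise : Term → Env × Pos × Pos → Set
Premise t (Γ , P , Q) = (P ∷ₑ Γ) ⊢ t ∶ Q

mutual
  size : ∀ {Γ t Q} → Γ ⊢ t ∶ Q → ℕ
  size (ax _)         = 0
  size (lam _ ds _ _) = sizeAll ds
  size (app d _ e _)  = suc (size d + size e)

  sizeAll : ∀ {t ps} → All (Premise t) ps → ℕ
  sizeAll []       = 0
  sizeAll (d ∷ ds) = size d + sizeAll ds

_⊢_∶_⟨_⟩ : Env → Term → Pos → ℕ → Set
Γ ⊢ t ∶ Q ⟨ n ⟩ = Σ (Γ ⊢ t ∶ Q) λ d → size d ≡ n

⨄-++ : ∀ (ps qs : List (Env × Pos × Pos)) →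
       ⨄ (map proj₁ (ps ++ qs)) ≈ₑ (⨄ (map proj₁ ps) ⊎ₑ ⨄ (map proj₁ qs))
⨄-++ []       qs = ≈ₑ-sym (⊎ₑ-identityˡ _)
⨄-++ (p ∷ ps) qs = ≈ₑ-trans (⊎ₑ-cong ≈ₑ-refl (⨄-++ ps qs)) (≈ₑ-sym (⊎ₑ-assoc (proj₁ p) _ _))

⨄-↭ : ∀ {ps qs : List (Env × Pos × Pos)} → ps ↭ qs → ⨄ (map proj₁ ps) ≈ₑ ⨄ (map proj₁ qs)
⨄-↭ ↭-refl         = ≈ₑ-refl
⨄-↭ (prep _ p)     = ⊎ₑ-cong ≈ₑ-refl (⨄-↭ p)
⨄-↭ (swap x y p)   = ≈ₑ-trans (≈ₑ-sym (⊎ₑ-assoc (proj₁ x) (proj₁ y) _))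
  (≈ₑ-trans (⊎ₑ-cong (⊎ₑ-comm (proj₁ x) (proj₁ y)) (⨄-↭ p)) (⊎ₑ-assoc (proj₁ y) (proj₁ x) _))
⨄-↭ (↭-trans p q) = ≈ₑ-trans (⨄-↭ p) (⨄-↭ q)

premises-↭ : ∀ {t ps qs} → ps ↭ qs → (ds : All (Premise t) ps) →
             Σ (All (Premise t) qs) λ es → sizeAll es ≡ sizeAll ds
premises-↭ ↭-refl ds = ds , refl
premises-↭ (prep _ p) (d ∷ ds) with premises-↭ p ds
... | es , e = d ∷ es , cong (size d +_) e
premises-↭ (swap _ _ p) (d ∷ d' ∷ ds) with premises-↭ p ds
... | es , e = d' ∷ d ∷ es ,
  trans (x∙yz≈y∙xz (size d') (size d) (sizeAll es)) (cong (λ n → size d + (size d' + n)) e)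
premises-↭ (↭-trans p q) ds with premises-↭ p ds
... | es , e with premises-↭ q es
... | fs , e' = fs , trans e' e

premises-++⁻ : ∀ {t} ps {qs} (ds : All (Premise t) (ps ++ qs)) →
               Σ (All (Premise t) ps) λ ds₁ → Σ (All (Premise t) qs) λ ds₂ →
                 sizeAll ds₁ + sizeAll ds₂ ≡ sizeAll ds
premises-++⁻ []       ds       = [] , ds , refl
premises-++⁻ (p ∷ ps) (d ∷ ds) with premises-++⁻ ps ds
... | ds₁ , ds₂ , e = d ∷ ds₁ , ds₂ , trans (+-assoc (size d) _ _) (cong (size d +_) e)

premises-++⁺ : ∀ {t ps qs} (ds₁ : All (Premise t) ps) (ds₂ : All (Premise t) qs) →
               Σ (All (Premise t) (ps ++ qs)) λ ds → sizeAll ds ≡ sizeAll ds₁ + sizeAll ds₂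
premises-++⁺ []        ds₂ = ds₂ , refl
premises-++⁺ (d ∷ ds₁) ds₂ with premises-++⁺ ds₁ ds₂
... | ds , e = d ∷ ds , trans (cong (size d +_) e) (sym (+-assoc (size d) _ _))

⊢-resp-≈ : ∀ {Γ Γ' t Q Q'} (d : Γ ⊢ t ∶ Q) → Γ ≈ₑ Γ' → Q ≈ Q' → Γ' ⊢ t ∶ Q' ⟨ size d ⟩
⊢-resp-≈ (ax {x = x} e)      g q = ax (≈ₑ-trans (≈ₑ-sym g) (≈ₑ-trans e (single-cong x q))) , refl
⊢-resp-≈ (lam ps ds eΓ eA)   g q = lam ps ds (≈ₑ-trans (≈ₑ-sym g) eΓ) (≈-trans (≈-sym q) eA) , refl
⊢-resp-≈ (app d eA e eΘ)     g q = app d (≈-trans eA (⇒-cong ≈-refl q)) e (≈ₑ-trans (≈ₑ-sym g) eΘ) , refl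

⊢⟨⟩-resp-≈ : ∀ {Γ Γ' t Q Q' n} → Γ ⊢ t ∶ Q ⟨ n ⟩ → Γ ≈ₑ Γ' → Q ≈ Q' → Γ' ⊢ t ∶ Q' ⟨ n ⟩
⊢⟨⟩-resp-≈ (d , refl) = ⊢-resp-≈ d

_⊢_∶_⟨≤_⟩ : Env → Term → Pos → ℕ → Set
Γ ⊢ t ∶ Q ⟨≤ n ⟩ = Σ (Γ ⊢ t ∶ Q) λ d → size d ≤ n

⊢⟨⟩⇒⊢⟨≤⟩ : ∀ {Γ t Q m n} → Γ ⊢ t ∶ Q ⟨ m ⟩ → m ≤ n → Γ ⊢ t ∶ Q ⟨≤ n ⟩
⊢⟨⟩⇒⊢⟨≤⟩ (d , refl) le = d , le

⊢⟨≤⟩-resp-≈ : ∀ {Γ Γ' t Q Q' n} → Γ ⊢ t ∶ Q ⟨≤ n ⟩ → Γ ≈ₑ Γ' → Q ≈ Q' → Γ' ⊢ t ∶ Q' ⟨≤ n ⟩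
⊢⟨≤⟩-resp-≈ (d , le) g q = ⊢⟨⟩⇒⊢⟨≤⟩ (⊢-resp-≈ d g q) le

⊢app : ∀ {Γ Δ Θ t u A P Q m n} → Γ ⊢ t ∶ A ⟨ m ⟩ → A ≈ (P ⇒ Q) → Δ ⊢ u ∶ P ⟨ n ⟩ →
       Θ ≈ₑ (Γ ⊎ₑ Δ) → Θ ⊢ app t u ∶ Q ⟨ suc (m + n) ⟩
⊢app (d , refl) eA (e , refl) eΘ = app d eA e eΘ , refl

⊢lam-𝟘 : ∀ {t Γ A} → Γ ≈ₑ ∅ → A ≈ 𝟘 → Γ ⊢ lam t ∶ A ⟨ 0 ⟩
⊢lam-𝟘 g a = lam [] [] g a , refl

⊢lam-⇒ : ∀ {t Γ P Q n} → (P ∷ₑ Γ) ⊢ t ∶ Q ⟨ n ⟩ → Γ ⊢ lam t ∶ (P ⇒ Q) ⟨ n ⟩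
⊢lam-⇒ {Γ = Γ} {P} {Q} (d , refl) =
  lam ((Γ , P , Q) ∷ []) (d ∷ []) (≈ₑ-sym (⊎ₑ-identityʳ Γ)) ≈-refl , +-identityʳ (size d)

⊢lam-⊎ : ∀ {t Γ₁ Γ₂ A₁ A₂ n₁ n₂} → Γ₁ ⊢ lam t ∶ A₁ ⟨ n₁ ⟩ → Γ₂ ⊢ lam t ∶ A₂ ⟨ n₂ ⟩ →
         (Γ₁ ⊎ₑ Γ₂) ⊢ lam t ∶ (A₁ ⊎ A₂) ⟨ n₁ + n₂ ⟩
⊢lam-⊎ (lam ps₁ ds₁ g₁ e₁ , refl) (lam ps₂ ds₂ g₂ e₂ , refl) with premises-++⁺ ds₁ ds₂
... | ds , e = lam (ps₁ ++ ps₂) ds (≈ₑ-trans (⊎ₑ-cong g₁ g₂) (≈ₑ-sym (⨄-++ ps₁ ps₂)))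
  (≈-trans (⊎-cong e₁ e₂) (≈-reflexive (cong mk (sym (map-++ proj₂ ps₁ ps₂))))) , e

-- A derivation of λx.t is, up to ≈, the ⊎ of one-premise derivations, one per premise.
record LamMotive (t : Term) (R : Env → Pos → ℕ → Set) : Set where
  field
    resp  : ∀ {Γ Γ' A A' n} → R Γ A n → Γ ≈ₑ Γ' → A ≈ A' → R Γ' A' n
    nil   : R ∅ 𝟘 0
    merge : ∀ {Γ₁ Γ₂ A₁ A₂ n₁ n₂} → R Γ₁ A₁ n₁ → R Γ₂ A₂ n₂ → R (Γ₁ ⊎ₑ Γ₂) (A₁ ⊎ A₂) (n₁ + n₂)
    one   : ∀ {Γ P Q} (d : (P ∷ₑ Γ) ⊢ t ∶ Q) → R Γ (P ⇒ Q) (size d)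

open LamMotive

lam-elim : ∀ {t R} → LamMotive t R → ∀ {Γ A} (d : Γ ⊢ lam t ∶ A) → R Γ A (size d)
lam-elim {t} {R} M (lam ps ds eΓ eA) = M .resp (fold ds) (≈ₑ-sym eΓ) (≈-sym eA)
  where
  fold : ∀ {ps} (ds : All (Premise t) ps) → R (⨄ (map proj₁ ps)) (mk (map proj₂ ps)) (sizeAll ds)
  fold []       = M .nil
  fold (d ∷ ds) = M .merge (M .one d) (fold ds)

-- Substitution

value⊢𝟘 : ∀ {v} → Value v → ∅ ⊢ v ∶ 𝟘
value⊢𝟘 (var {x}) = ax (≈ₑ-sym (single-𝟘 x))
value⊢𝟘 lam       = proj₁ (⊢lam-𝟘 ≈ₑ-refl ≈-refl)

value⊢𝟘-inv : ∀ {v Δ P} → Value v → Δ ⊢ v ∶ P → P ≈ 𝟘 → Δ ≈ₑ ∅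
value⊢𝟘-inv var (ax {x = x} e)    p = ≈ₑ-trans e (≈ₑ-trans (single-cong x p) (single-𝟘 x))
value⊢𝟘-inv lam (lam []      _ eΓ _)  p = eΓ
value⊢𝟘-inv lam (lam (_ ∷ _) _ _  eA) p with () ← ≈𝟘-inv (≈-trans (≈-sym eA) p)

value-⊢-split : ∀ {v Δ P} → Value v → (d : Δ ⊢ v ∶ P) → ∀ P₁ P₂ → P ≈ (P₁ ⊎ P₂) →
                ∃[ Δ₁ ] ∃[ Δ₂ ] Σ (Δ₁ ⊢ v ∶ P₁) λ d₁ → Σ (Δ₂ ⊢ v ∶ P₂) λ d₂ →
                  (Δ ≈ₑ (Δ₁ ⊎ₑ Δ₂)) × (size d₁ + size d₂ ≡ size d)
value-⊢-split var (ax {x = x} e) P₁ P₂ h =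
  single x P₁ , single x P₂ , ax ≈ₑ-refl , ax ≈ₑ-refl ,
  ≈ₑ-trans e (≈ₑ-trans (single-cong x h) (single-⊎ x P₁ P₂)) , refl
value-⊢-split lam (lam ps ds eΓ eA) (mk xs) (mk ys) h
  with ≈-map-++-inv proj₂ ps xs ys (≈-trans (≈-sym eA) h)
... | ps₁ , ps₂ , ps↭ , e₁ , e₂ with premises-↭ ps↭ ds
... | ds' , e' with premises-++⁻ ps₁ ds'
... | ds₁ , ds₂ , e = _ , _ , lam ps₁ ds₁ ≈ₑ-refl (≈-sym e₁) , lam ps₂ ds₂ ≈ₑ-refl (≈-sym e₂) ,
  ≈ₑ-trans eΓ (≈ₑ-trans (⨄-↭ ps↭) (⨄-++ ps₁ ps₂)) , trans e e'

value-⊢-⊎ : ∀ {v Δ₁ Δ₂ P₁ P₂} → Value v → Δ₁ ⊢ v ∶ P₁ → Δ₂ ⊢ v ∶ P₂ → (Δ₁ ⊎ₑ Δ₂) ⊢ v ∶ (P₁ ⊎ P₂)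
value-⊢-⊎ var (ax {x = x} {P = P₁} e₁) (ax {P = P₂} e₂) =
  ax (≈ₑ-trans (⊎ₑ-cong e₁ e₂) (≈ₑ-sym (single-⊎ x P₁ P₂)))
value-⊢-⊎ lam d₁ d₂ = proj₁ (⊢lam-⊎ (d₁ , refl) (d₂ , refl))

⊢-shift : ∀ t c {E Q} (d : E ⊢ t ∶ Q) → insertAt E c 𝟘 ⊢ shift c t ∶ Q ⟨ size d ⟩
⊢-shift (var x) c {Q = Q} (ax e) rewrite shift-var c x =
  ax (≈ₑ-trans (insertAt-cong c e ≈-refl) (insertAt-single c x Q)) , refl
⊢-shift (app t u) c (app {Γ = Γ} {Δ = Δ} d eA e eΘ) =
  ⊢app (⊢-shift t c d) eA (⊢-shift u c e) (≈ₑ-trans (insertAt-cong c eΘ ≈-refl) (insertAt-⊎ Γ Δ c 𝟘 𝟘))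
⊢-shift (lam t) c = lam-elim M
  where
  M : LamMotive t (λ Γ A n → insertAt Γ c 𝟘 ⊢ lam (shift (suc c) t) ∶ A ⟨ n ⟩)
  M .resp d g = ⊢⟨⟩-resp-≈ d (insertAt-cong c g ≈-refl)
  M .nil = ⊢lam-𝟘 (insertAt-∅ c) ≈-refl
  M .merge {Γ₁} {Γ₂} d₁ d₂ = ⊢⟨⟩-resp-≈ (⊢lam-⊎ d₁ d₂) (≈ₑ-sym (insertAt-⊎ Γ₁ Γ₂ c 𝟘 𝟘)) ≈-refl
  M .one d = ⊢lam-⇒ (⊢-shift t (suc c) d)

⊢-unshift : ∀ t c {E Q} → E ⊢ shift c t ∶ Q → (E c ≈ 𝟘) × (removeAt E c ⊢ t ∶ Q)
⊢-unshift (var x) c {Q = Q} d rewrite shift-var c x with d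
... | ax e = ≈-trans (e c) (≈-reflexive (single-punchIn-at c x Q)) ,
             ax (λ y → ≈-trans (e (punchIn c y)) (≈-reflexive (single-punchIn c x Q y)))
⊢-unshift (app t u) c (app d eA e eΘ) with ⊢-unshift t c d | ⊢-unshift u c e
... | z₁ , d' | z₂ , e' = ≈-trans (eΘ c) (⊎-cong z₁ z₂) , app d' eA e' (λ y → eΘ (punchIn c y))
⊢-unshift (lam t) c = lam-elim M
  where
  M : LamMotive (shift (suc c) t) (λ Γ A _ → (Γ c ≈ 𝟘) × (removeAt Γ c ⊢ lam t ∶ A))
  M .resp (z , d) g a = ≈-trans (≈-sym (g c)) z , proj₁ (⊢-resp-≈ d (λ y → g (punchIn c y)) a)
  M .nil = ≈-refl , proj₁ (⊢lam-𝟘 ≈ₑ-refl ≈-refl)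
  M .merge (z₁ , d₁) (z₂ , d₂) = ⊎-cong z₁ z₂ , proj₁ (⊢lam-⊎ (d₁ , refl) (d₂ , refl))
  M .one {Γ} {P} d with ⊢-unshift t (suc c) d
  ... | z , d' = z , proj₁ (⊢lam-⇒ (⊢-resp-≈ d' (removeAt-∷ₑ P Γ c) ≈-refl))

value-shift : ∀ {s} c → Value s → Value (shift c s)
value-shift {var x} c var rewrite shift-var c x = var
value-shift         c lam = lam

insertAt-⊎ₑ-inv : ∀ j {E Γ P G₁ G₂} → E ≈ₑ insertAt Γ j P → E ≈ₑ (G₁ ⊎ₑ G₂) →
                  (P ≈ (G₁ j ⊎ G₂ j)) × (Γ ≈ₑ (removeAt G₁ j ⊎ₑ removeAt G₂ j))
insertAt-⊎ₑ-inv j g e =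
  ≈-trans (≈-sym (≈ₑ-insertAt-here j g)) (e j) ,
  λ y → ≈-trans (≈-sym (≈ₑ-insertAt-removeAt j g y)) (e (punchIn j y))

+-mono-≤-interchange : ∀ b c b' c' {a a' k} →
                       a ≤ b + c → a' ≤ b' + c' → c + c' ≡ k → a + a' ≤ (b + b') + k
+-mono-≤-interchange b c b' c' le le' refl =
  ≤-trans (+-mono-≤ le le') (≤-reflexive (+-interchange b c b' c'))

⊢-subst-var : ∀ x j s {E Q} → Value s → E ⊢ var x ∶ Q →
              ∀ {Γ P Δ} → E ≈ₑ insertAt Γ j P → (ds : Δ ⊢ s ∶ P) →
              (Γ ⊎ₑ Δ) ⊢ subst j s (var x) ∶ Q ⟨≤ size ds ⟩
⊢-subst-var x j s vs (ax {P = Q} e) {Γ} {P} {Δ} g ds with punchInView j x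
... | here rewrite subst-var-here j s
  with insertAt-injective j (≈ₑ-trans (≈ₑ-sym g) (≈ₑ-trans e (≈ₑ-sym (insertAt-∅-single j Q))))
... | P≈Q , Γ≈∅ = ⊢⟨≤⟩-resp-≈ (ds , ≤-refl)
                    (≈ₑ-trans (≈ₑ-sym (⊎ₑ-identityˡ Δ)) (⊎ₑ-cong (≈ₑ-sym Γ≈∅) ≈ₑ-refl)) P≈Q
⊢-subst-var x j s vs (ax {P = Q} e) {Γ} {P} {Δ} g ds | there y rewrite subst-var-punchIn j y s
  with insertAt-injective j (≈ₑ-trans (≈ₑ-sym g) (≈ₑ-trans e (≈ₑ-sym (insertAt-single j y Q))))
... | P≈𝟘 , Γ≈y = ax (≈ₑ-trans (⊎ₑ-cong Γ≈y (value⊢𝟘-inv vs ds P≈𝟘)) (⊎ₑ-identityʳ _)) , z≤n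

⊢-subst : ∀ t j s {E Q} → Value s → (d : E ⊢ t ∶ Q) →
          ∀ {Γ P Δ} → E ≈ₑ insertAt Γ j P → (ds : Δ ⊢ s ∶ P) →
          (Γ ⊎ₑ Δ) ⊢ subst j s t ∶ Q ⟨≤ size d + size ds ⟩
⊢-subst (var x) j s vs d@(ax _) = ⊢-subst-var x j s vs d
⊢-subst (app t u) j s vs (app {Γ = G₁} {Δ = G₂} d₁ eA d₂ eΘ) g ds
  with insertAt-⊎ₑ-inv j g eΘ
... | P≈ , Γ≈ with value-⊢-split vs ds (G₁ j) (G₂ j) P≈
... | _ , _ , ds₁ , ds₂ , Δ≈ , es
  with ⊢-subst t j s vs d₁ (insertAt-removeAt G₁ j) ds₁
     | ⊢-subst u j s vs d₂ (insertAt-removeAt G₂ j) ds₂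
... | d₁' , le₁ | d₂' , le₂ =
  app d₁' eA d₂' (≈ₑ-trans (⊎ₑ-cong Γ≈ Δ≈) (⊎ₑ-interchange _ _ _ _)) ,
  s≤s (+-mono-≤-interchange (size d₁) (size ds₁) (size d₂) (size ds₂) le₁ le₂ es)
⊢-subst (lam t) j s vs = lam-elim M
  where
  M : LamMotive t (λ G A n → ∀ {Γ P Δ} → G ≈ₑ insertAt Γ j P → (ds : Δ ⊢ s ∶ P) →
                     (Γ ⊎ₑ Δ) ⊢ lam (subst (suc j) (shift 0 s) t) ∶ A ⟨≤ n + size ds ⟩)
  M .resp r g a h ds = ⊢⟨≤⟩-resp-≈ (r (≈ₑ-trans g h) ds) ≈ₑ-refl a
  M .nil h ds with insertAt-injective j (≈ₑ-trans (≈ₑ-sym h) (≈ₑ-sym (insertAt-∅ j)))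
  ... | P≈𝟘 , Γ≈∅ = ⊢⟨⟩⇒⊢⟨≤⟩ (⊢lam-𝟘 (⊎ₑ-cong Γ≈∅ (value⊢𝟘-inv vs ds P≈𝟘)) ≈-refl) z≤n
  M .merge {G₁} {G₂} {n₁ = n₁} {n₂} r₁ r₂ h ds with insertAt-⊎ₑ-inv j h ≈ₑ-refl
  ... | P≈ , Γ≈ with value-⊢-split vs ds (G₁ j) (G₂ j) P≈
  ... | _ , _ , ds₁ , ds₂ , Δ≈ , es
    with r₁ (insertAt-removeAt G₁ j) ds₁ | r₂ (insertAt-removeAt G₂ j) ds₂
  ... | d₁ , le₁ | d₂ , le₂ =
    ⊢⟨⟩⇒⊢⟨≤⟩ (⊢⟨⟩-resp-≈ (⊢lam-⊎ (d₁ , refl) (d₂ , refl))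
                (≈ₑ-sym (≈ₑ-trans (⊎ₑ-cong Γ≈ Δ≈) (⊎ₑ-interchange _ _ _ _))) ≈-refl)
             (+-mono-≤-interchange n₁ (size ds₁) n₂ (size ds₂) le₁ le₂ es)
  M .one {G} {P'} d {Γ} {P} {Δ} h ds with ⊢-shift s 0 ds
  ... | ds' , es with ⊢-subst t (suc j) (shift 0 s) (value-shift 0 vs) d (∷ₑ-cong ≈-refl h) ds'
  ... | d' , le =
    ⊢⟨⟩⇒⊢⟨≤⟩ (⊢lam-⇒ (⊢-resp-≈ d' (≈ₑ-trans (∷ₑ-⊎ₑ P' 𝟘 Γ Δ) (∷ₑ-cong (⊎-identityʳ P') ≈ₑ-refl)) ≈-refl))
             (≤-trans le (≤-reflexive (cong (size d +_) es)))

Unsubst : ℕ → Term → Term → Env → Pos → Set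
Unsubst j t s Γ Q = ∃[ P ] ∃[ Γ₁ ] ∃[ Δ ] ((insertAt Γ₁ j P ⊢ t ∶ Q) × (Δ ⊢ s ∶ P) × (Γ ≈ₑ (Γ₁ ⊎ₑ Δ)))

⊢-unsubst : ∀ t j s {Γ Q} → Value s → Γ ⊢ subst j s t ∶ Q → Unsubst j t s Γ Q
⊢-unsubst (var x) j s {Γ} {Q} vs d with punchInView j x
... | here rewrite subst-var-here j s =
  Q , ∅ , Γ , ax (insertAt-∅-single j Q) , d , ≈ₑ-sym (⊎ₑ-identityˡ Γ)
... | there y rewrite subst-var-punchIn j y s with d
... | ax e = 𝟘 , Γ , ∅ , ax (≈ₑ-trans (insertAt-cong j e ≈-refl) (insertAt-single j y Q)) ,
             value⊢𝟘 vs , ≈ₑ-sym (⊎ₑ-identityʳ Γ)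
⊢-unsubst (app t u) j s vs (app d₁ eA d₂ eΘ) with ⊢-unsubst t j s vs d₁ | ⊢-unsubst u j s vs d₂
... | P₁ , Γ₁ , Δ₁ , d₁' , ds₁ , e₁ | P₂ , Γ₂ , Δ₂ , d₂' , ds₂ , e₂ =
  P₁ ⊎ P₂ , Γ₁ ⊎ₑ Γ₂ , Δ₁ ⊎ₑ Δ₂ , app d₁' eA d₂' (insertAt-⊎ Γ₁ Γ₂ j P₁ P₂) , value-⊢-⊎ vs ds₁ ds₂ ,
  ≈ₑ-trans eΘ (≈ₑ-trans (⊎ₑ-cong e₁ e₂) (⊎ₑ-interchange _ _ _ _))
⊢-unsubst (lam t) j s vs = lam-elim M
  where
  M : LamMotive (subst (suc j) (shift 0 s) t) (λ G A _ → Unsubst j (lam t) s G A)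
  M .resp (P , Γ₁ , Δ , d , ds , e) g a =
    P , Γ₁ , Δ , proj₁ (⊢-resp-≈ d ≈ₑ-refl a) , ds , ≈ₑ-trans (≈ₑ-sym g) e
  M .nil = 𝟘 , ∅ , ∅ , proj₁ (⊢lam-𝟘 (insertAt-∅ j) ≈-refl) , value⊢𝟘 vs , ≈ₑ-sym (⊎ₑ-identityˡ ∅)
  M .merge (P₁ , Γ₁ , Δ₁ , d₁ , ds₁ , e₁) (P₂ , Γ₂ , Δ₂ , d₂ , ds₂ , e₂) =
    P₁ ⊎ P₂ , Γ₁ ⊎ₑ Γ₂ , Δ₁ ⊎ₑ Δ₂ ,
    proj₁ (⊢⟨⟩-resp-≈ (⊢lam-⊎ (d₁ , refl) (d₂ , refl)) (≈ₑ-sym (insertAt-⊎ Γ₁ Γ₂ j P₁ P₂)) ≈-refl) ,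
    value-⊢-⊎ vs ds₁ ds₂ , ≈ₑ-trans (⊎ₑ-cong e₁ e₂) (⊎ₑ-interchange _ _ _ _)
  M .one {P = P'} d with ⊢-unsubst t (suc j) (shift 0 s) (value-shift 0 vs) d
  ... | P , Γ₁ , Δ , d' , ds , e with ⊢-unshift s 0 ds
  ... | Δ₀≈𝟘 , ds' =
    P , (λ y → Γ₁ (suc y)) , (λ y → Δ (suc y)) ,
    proj₁ (⊢lam-⇒ (⊢-resp-≈ d' (∷ₑ-cong Γ₁₀≈P' ≈ₑ-refl) ≈-refl)) , ds' , (λ y → e (suc y))
    where
    Γ₁₀≈P' : Γ₁ zero ≈ P'
    Γ₁₀≈P' = ≈-sym (≈-trans (e zero) (≈-trans (⊎-cong ≈-refl Δ₀≈𝟘) (⊎-identityʳ (Γ₁ zero))))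

-- Subject reduction and expansion

⊢lam-⇒-inv : ∀ {t G A P Q} (d : G ⊢ lam t ∶ A) → A ≈ (P ⇒ Q) → (P ∷ₑ G) ⊢ t ∶ Q ⟨ size d ⟩
⊢lam-⇒-inv (lam [] _ _ eA) h with _ , () , _ ← ≈-singleton-inv (≈-trans (≈-sym eA) h)
⊢lam-⇒-inv (lam (_ ∷ _ ∷ _) _ _ eA) h with _ , () , _ ← ≈-singleton-inv (≈-trans (≈-sym eA) h)
⊢lam-⇒-inv (lam ((G₁ , _ , _) ∷ []) (d ∷ []) eG eA) h
  with _ , refl , (p , q) ← ≈-singleton-inv (≈-trans (≈-sym eA) h)
  with d' , e ← ⊢-resp-≈ d (∷ₑ-cong p (≈ₑ-sym (≈ₑ-trans eG (⊎ₑ-identityʳ G₁)))) q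
  = d' , trans e (sym (+-identityʳ (size d)))

⊢lam-map : ∀ {t t'} → (∀ {Γ Q} → Γ ⊢ t ∶ Q → Γ ⊢ t' ∶ Q) → ∀ {Γ A} → Γ ⊢ lam t ∶ A → Γ ⊢ lam t' ∶ A
⊢lam-map {t} {t'} f = lam-elim M
  where
  M : LamMotive t (λ Γ A _ → Γ ⊢ lam t' ∶ A)
  M .resp d g a = proj₁ (⊢-resp-≈ d g a)
  M .nil = proj₁ (⊢lam-𝟘 ≈ₑ-refl ≈-refl)
  M .merge d₁ d₂ = proj₁ (⊢lam-⊎ (d₁ , refl) (d₂ , refl))
  M .one d = proj₁ (⊢lam-⇒ (f d , refl))

⊢-βv : ∀ {Θ t v Q} → Value v → (d : Θ ⊢ app (lam t) v ∶ Q) → Σ (Θ ⊢ t [ v ] ∶ Q) λ d' → size d' < size d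
⊢-βv {t = t} {v} vv (app dl eA dv eΘ) with ⊢lam-⇒-inv dl eA
... | db , eb with ⊢-subst t 0 v vv db ≈ₑ-refl dv
... | d' , le with ⊢⟨≤⟩-resp-≈ (d' , ≤-trans le (≤-reflexive (cong (_+ size dv) eb))) (≈ₑ-sym eΘ) ≈-refl
... | d'' , le' = d'' , s≤s le'

⊢-βv⁻¹ : ∀ {Θ t v Q} → Value v → Θ ⊢ t [ v ] ∶ Q → Θ ⊢ app (lam t) v ∶ Q
⊢-βv⁻¹ {t = t} {v} vv d with ⊢-unsubst t 0 v vv d
... | P , Γ₁ , Δ , dt , dv , e = app (proj₁ (⊢lam-⇒ (dt , refl))) ≈-refl dv e

⊢-▷ : ∀ {t t' Γ Q} → t ▷ t' → (d : Γ ⊢ t ∶ Q) → Σ (Γ ⊢ t' ∶ Q) λ d' → size d' < size d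
⊢-▷ (root (βv vv)) d = ⊢-βv vv d
⊢-▷ (appL r) (app d eA e eΘ) with ⊢-▷ r d
... | d' , lt = app d' eA e eΘ , s≤s (+-monoˡ-< (size e) lt)
⊢-▷ (appR r) (app d eA e eΘ) with ⊢-▷ r e
... | e' , lt = app d eA e' eΘ , s≤s (+-monoʳ-< (size d) lt)
⊢-▷ (redexB r) (app dl eA e eΘ) with ⊢lam-⇒-inv dl eA
... | db , eb with ⊢-▷ r db
... | db' , lt with ⊢lam-⇒ (db' , refl)
... | dl' , el = app dl' ≈-refl e eΘ , s≤s (+-monoˡ-< (size e) dl'<dl)
  where
  open ≤-Reasoning
  dl'<dl : size dl' < size dl
  dl'<dl = begin-strict size dl' ≡⟨ el ⟩ size db' <⟨ lt ⟩ size db ≡⟨ eb ⟩ size dl ∎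

⊢-→βv : ∀ {t t' Γ Q} → t →βv t' → Γ ⊢ t ∶ Q → Γ ⊢ t' ∶ Q
⊢-→βv (root (βv vv)) d                = proj₁ (⊢-βv vv d)
⊢-→βv (lamC r)       d                = ⊢lam-map (⊢-→βv r) d
⊢-→βv (appL r)       (app d eA e eΘ) = app (⊢-→βv r d) eA e eΘ
⊢-→βv (appR r)       (app d eA e eΘ) = app d eA (⊢-→βv r e) eΘ

⊢-←βv : ∀ {t t' Γ Q} → t →βv t' → Γ ⊢ t' ∶ Q → Γ ⊢ t ∶ Q
⊢-←βv (root (βv vv)) d                = ⊢-βv⁻¹ vv d
⊢-←βv (lamC r)       d                = ⊢lam-map (⊢-←βv r) d
⊢-←βv (appL r)       (app d eA e eΘ) = app (⊢-←βv r d) eA e eΘ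
⊢-←βv (appR r)       (app d eA e eΘ) = app d eA (⊢-←βv r e) eΘ

⊢-resp-≃βv : ∀ {t t' Γ Q} → t ≃βv t' → Γ ⊢ t' ∶ Q → Γ ⊢ t ∶ Q
⊢-resp-≃βv ε              d = d
⊢-resp-≃βv (fwd r ◅ rs) d = ⊢-←βv r (⊢-resp-≃βv rs d)
⊢-resp-≃βv (bwd r ◅ rs) d = ⊢-→βv r (⊢-resp-≃βv rs d)

-- Normalization

⊢⇒▷-SN′ : ∀ n {Γ t Q} (d : Γ ⊢ t ∶ Q) → size d < n → ▷-SN t
⊢⇒▷-SN′ (suc n) d (s≤s le) = acc λ r → let d' , lt = ⊢-▷ r d in ⊢⇒▷-SN′ n d' (≤-trans lt le)

⊢⇒▷-SN : ∀ {Γ t Q} → Γ ⊢ t ∶ Q → ▷-SN t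
⊢⇒▷-SN d = ⊢⇒▷-SN′ (suc (size d)) d ≤-refl

mutual
  ▷-progress : ∀ t → (∃ λ t' → t ▷ t') ⊎′ ▷-Normal t
  ▷-progress (var x) = inj₂ λ { (root ()) }
  ▷-progress (lam t) = inj₂ λ { (root ()) }
  ▷-progress (app t u) with ▷-progress t
  ... | inj₁ (_ , r) = inj₁ (_ , appL r)
  ... | inj₂ nt with ▷-progress u
  ... | inj₁ (_ , r) = inj₁ (_ , appR r)
  ... | inj₂ nu = app-progress t u nt nu

  app-progress : ∀ t u → ▷-Normal t → ▷-Normal u → (∃ λ t' → app t u ▷ t') ⊎′ ▷-Normal (app t u)
  app-progress (lam b) (var x) nt nu = inj₁ (_ , root (βv var))
  app-progress (lam b) (lam c) nt nu = inj₁ (_ , root (βv lam))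
  app-progress (lam b) (app u₁ u₂) nt nu with ▷-progress b
  ... | inj₁ (_ , r) = inj₁ (_ , redexB r)
  ... | inj₂ nb = inj₂ λ { (root (βv ())) ; (redexB r) → nb r ; (appL r) → nt r ; (appR r) → nu r }
  app-progress (var x) u nt nu = inj₂ λ { (root ()) ; (appL r) → nt r ; (appR r) → nu r }
  app-progress (app t₁ t₂) u nt nu = inj₂ λ { (root ()) ; (appL r) → nt r ; (appR r) → nu r }

▷-SN⇒▷-Normalizable : ∀ {t} → ▷-SN t → ▷-Normalizable t
▷-SN⇒▷-Normalizable {t} (acc rs) with ▷-progress t
... | inj₂ nt = t , ε , nt
... | inj₁ (_ , r) with ▷-SN⇒▷-Normalizable (rs r)
... | u , rs' , nu = u , r ◅ rs' , nu

punchIn-≤ : ∀ c x → punchIn c x ≤ suc x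
punchIn-≤ zero    x       = ≤-refl
punchIn-≤ (suc c) zero    = z≤n
punchIn-≤ (suc c) (suc x) = s≤s (punchIn-≤ c x)

punchIn-<⁻ : ∀ j y n → j ≤ n → punchIn j y < suc n → y < n
punchIn-<⁻ zero    y       n       _         (s≤s lt) = lt
punchIn-<⁻ (suc j) zero    (suc n) _         _        = s≤s z≤n
punchIn-<⁻ (suc j) (suc y) (suc n) (s≤s jn) (s≤s lt) = s≤s (punchIn-<⁻ j y n jn lt)

ClosedAt-shift : ∀ {n} s c → ClosedAt n s → ClosedAt (suc n) (shift c s)
ClosedAt-shift (var x)   c (var lt) rewrite shift-var c x = var (≤-trans (s≤s (punchIn-≤ c x)) (s≤s lt))
ClosedAt-shift (lam s)   c (lam h)   = lam (ClosedAt-shift s (suc c) h)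
ClosedAt-shift (app s u) c (app h k) = app (ClosedAt-shift s c h) (ClosedAt-shift u c k)

ClosedAt-subst : ∀ t j s n → j ≤ n → ClosedAt (suc n) t → ClosedAt n s → ClosedAt n (subst j s t)
ClosedAt-subst (var x) j s n jn (var lt) cs with punchInView j x
... | here    rewrite subst-var-here j s      = cs
... | there y rewrite subst-var-punchIn j y s = var (punchIn-<⁻ j y n jn lt)
ClosedAt-subst (lam t) j s n jn (lam h) cs =
  lam (ClosedAt-subst t (suc j) (shift 0 s) (suc n) (s≤s jn) h (ClosedAt-shift s 0 cs))
ClosedAt-subst (app t u) j s n jn (app h k) cs =
  app (ClosedAt-subst t j s n jn h cs) (ClosedAt-subst u j s n jn k cs)

ClosedAt-▷ : ∀ {n t t'} → t ▷ t' → ClosedAt n t → ClosedAt n t'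
ClosedAt-▷ {n} (root (βv {t = t} {v} _)) (app (lam h) k) = ClosedAt-subst t 0 v n z≤n h k
ClosedAt-▷ (redexB r) (app (lam h) k) = app (lam (ClosedAt-▷ r h)) k
ClosedAt-▷ (appL r)   (app h k)       = app (ClosedAt-▷ r h) k
ClosedAt-▷ (appR r)   (app h k)       = app h (ClosedAt-▷ r k)

ClosedAt-▷* : ∀ {n t t'} → t ▷* t' → ClosedAt n t → ClosedAt n t'
ClosedAt-▷* ε        h = h
ClosedAt-▷* (r ◅ rs) h = ClosedAt-▷* rs (ClosedAt-▷ r h)

closed-▷-normal⇒value : ∀ {t} → Closed t → ▷-Normal t → Value t
closed-▷-normal⇒value (var ())
closed-▷-normal⇒value (lam _) _ = lam
closed-▷-normal⇒value (app h k) nt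
  with closed-▷-normal⇒value h (nt ∘ appL) | closed-▷-normal⇒value k (nt ∘ appR)
closed-▷-normal⇒value (app (var ()) _) _ | var | _
... | lam | vu = ⊥-elim (nt (root (βv vu)))

value⇒▷-normal : ∀ {v} → Value v → ▷-Normal v
value⇒▷-normal var (root ())
value⇒▷-normal lam (root ())

▷⇒→βv : ∀ {t t'} → t ▷ t' → t →βv t'
▷⇒→βv (root r)   = root r
▷⇒→βv (redexB r) = appL (lamC (▷⇒→βv r))
▷⇒→βv (appL r)   = appL (▷⇒→βv r)
▷⇒→βv (appR r)   = appR (▷⇒→βv r)

▷*⇒≃βv : ∀ {t t'} → t ▷* t' → t ≃βv t'
▷*⇒≃βv ε        = ε
▷*⇒≃βv (r ◅ rs) = fwd (▷⇒→βv r) ◅ ▷*⇒≃βv rs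

envOf-𝟘 : ∀ xs → envOf xs (replicate (length xs) 𝟘) ≈ₑ ∅
envOf-𝟘 []       = ≈ₑ-refl
envOf-𝟘 (x ∷ xs) = ≈ₑ-trans (⊎ₑ-cong (single-𝟘 x) (envOf-𝟘 xs)) (⊎ₑ-identityˡ ∅)

closed-▷-Normalizable⇒value : ∀ {t} → Closed t → ▷-Normalizable t → ∃ λ v → Value v × Closed v × (t ▷* v)
closed-▷-Normalizable⇒value ct (v , rs , nv) =
  let cv = ClosedAt-▷* rs ct in v , closed-▷-normal⇒value cv nv , cv , rs

⊢⇒▷-Normalizable : ∀ {Γ t Q} → Γ ⊢ t ∶ Q → ▷-Normalizable t
⊢⇒▷-Normalizable = ▷-SN⇒▷-Normalizable ∘ ⊢⇒▷-SN

≃βv-value⇒⊢𝟘 : ∀ {t v} → Value v → t ≃βv v → ∅ ⊢ t ∶ 𝟘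
≃βv-value⇒⊢𝟘 vv eq = ⊢-resp-≃βv eq (value⊢𝟘 vv)

mainTheorem6 : (t : Term) → Closed t →
    let c1 = ▷-Normalizable t
        c2 = ∃ λ v → Value v × Closed v × (t ▷* v)
        c3 = ∃ λ v → Value v × Closed v × (t ≃βv v)
        c4 = (xs : List ℕ) → Unique xs → ∃ λ PsQ → (⟦ t ⟧ xs) PsQ
        c5 = (xs : List ℕ) → Unique xs → (⟦ t ⟧ xs) (replicate (length xs) 𝟘 , 𝟘)
        c6 = ∅ ⊢ t ∶ 𝟘
        c7 = ∃ λ Q → ∅ ⊢ t ∶ Q
        c8 = ▷-SN t
    in (c1 ⇔ c2) × (c1 ⇔ c3) × (c1 ⇔ c4) × (c1 ⇔ c5)
       × (c1 ⇔ c6) × (c1 ⇔ c7) × (c1 ⇔ c8)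
mainTheorem6 t ct =
  mk⇔ 1→2 (λ (v , vv , _ , rs) → v , rs , value⇒▷-normal vv) ,
  mk⇔ (λ h → let v , vv , cv , rs = 1→2 h in v , vv , cv , ▷*⇒≃βv rs)
      (λ (_ , vv , _ , eq) → ⊢⇒▷-Normalizable (≃βv-value⇒⊢𝟘 vv eq)) ,
  mk⇔ (λ h xs u → _ , 1→5 h xs u) (λ h → ⊢⇒▷-Normalizable (proj₂ (h [] []))) ,
  mk⇔ 1→5 (λ h → ⊢⇒▷-Normalizable (h [] [])) ,
  mk⇔ 1→6 ⊢⇒▷-Normalizable ,
  mk⇔ (λ h → 𝟘 , 1→6 h) (⊢⇒▷-Normalizable ∘ proj₂) ,
  mk⇔ (⊢⇒▷-SN ∘ 1→6) ▷-SN⇒▷-Normalizable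
  where
  1→2 : ▷-Normalizable t → ∃ λ v → Value v × Closed v × (t ▷* v)
  1→2 = closed-▷-Normalizable⇒value ct
  1→6 : ▷-Normalizable t → ∅ ⊢ t ∶ 𝟘
  1→6 h = let _ , vv , _ , rs = 1→2 h in ≃βv-value⇒⊢𝟘 vv (▷*⇒≃βv rs)
  1→5 : ▷-Normalizable t → (xs : List ℕ) → Unique xs → (⟦ t ⟧ xs) (replicate (length xs) 𝟘 , 𝟘)
  1→5 h xs _ = proj₁ (⊢-resp-≈ (1→6 h) (≈ₑ-sym (envOf-𝟘 xs)) ≈-refl)
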